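{- Let $\Sigma$ be a finite propositional signature, let $v\in\mathcal I$ be a partial interpretation and let $\alpha$ be a formula over $\Sigma$. Then: (i) $v(\alpha)=2$ (in the $G_3$ valuation) if and only if $v\in[\![\alpha]\!]$; (ii) $v(\alpha)\neq 0$ (in the $G_3$ valuation) if and only if $v_t\in[\![\alpha]\!]$.
   Context: $\Sigma$ is a finite set of atoms. Formulas are given by $\alpha ::= \bot \mid p \mid \alpha_1\wedge\alpha_2 \mid \alpha_1\vee\alpha_2 \mid \alpha_1\rightarrow\alpha_2$ with $p\in\Sigma$. A partial interpretation is a map $v:\Sigma\to\{0,1,2\}$; $\mathcal I$ is the set of all partial interpretations and $\mathcal I_c\subseteq\mathcal I$ the set of classical ones (those with $v(p)\neq 1$ for all $p$). For $v\in\mathcal I$, $v_t\in\mathcal I_c$ is defined by $v_t(p)=2$ if $v(p)=1$ and $v_t(p)=v(p)$ otherwise. The $G_3$ valuation extends $v$ to formulas: $v(\bot)=0$, $v(\alpha\wedge\beta)=\min(v(\alpha),v(\beta))$, $v(\alpha\vee\beta)=\max(v(\alpha),v(\beta))$, $v(\alpha\to\beta)=2$ if $v(\alpha)\le v(\beta)$ and $v(\alpha\to\beta)=v(\beta)$ otherwise. The order on $\mathcal I$: $u\le v$ iff for every atom $p$, $u(p)\le v(p)$ and ($u(p)=0$ implies $v(p)=0$). For $S\subseteq\mathcal I$: $\overline S=\mathcal I\setminus S$; $S_c=S\cap\mathcal I_c$; $S\downarrow=\{u\in\mathcal I:\exists v\in S,\ v\ge u\}$; $S\uparrow=\{u\in\mathcal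 I:\exists v\in S,\ v\le u\}$ (these three postfix operations bind tighter than $\cup,\cap,\setminus$ and are applied left to right, so $S_c\downarrow=(S_c)\downarrow$). The denotation $[\![\cdot]\!]$ is defined recursively: $[\![\bot]\!]=\emptyset$; $[\![p]\!]=\{v\in\mathcal I: v(p)=2\}$; $[\![\alpha\wedge\beta]\!]=[\![\alpha]\!]\cap[\![\beta]\!]$; $[\![\alpha\vee\beta]\!]=[\![\alpha]\!]\cup[\![\beta]\!]$; $[\![\alpha\to\beta]\!]=\big(\overline{[\![\alpha]\!]}\cup[\![\beta]\!]\big)\cap\big(\overline{[\![\alpha]\!]}\cup[\![\beta]\!]\big)_c\downarrow$. -}

module Defs where

open import Data.Nat using (ℕ)
open import Data.Fin using (Fin)
open import Data.Product using (Σ; _×_)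
open import Data.Sum using (_⊎_)
open import Data.Empty using (⊥)
open import Relation.Nullary using (¬_)
open import Relation.Binary.PropositionalEquality using (_≡_)

-- Truth values of G3: 0 (false), 1 (undefined), 2 (true).
data V3 : Set where
  v0 v1 v2 : V3

data _≤₃_ : V3 → V3 → Set where
  0≤any : ∀ {x} → v0 ≤₃ x
  1≤1   : v1 ≤₃ v1
  1≤2   : v1 ≤₃ v2
  2≤2   : v2 ≤₃ v2

min₃ : V3 → V3 → V3
min₃ v0 _  = v0
min₃ v1 v0 = v0
min₃ v1 _  = v1
min₃ v2 y  = y

max₃ : V3 → V3 → V3
max₃ v0 y  = y
max₃ v1 v2 = v2
max₃ v1 _  = v1
max₃ v2 _  = v2

data Formula (n : ℕ) : Set where
  ⊥f   : Formula n
  atom : Fin n → Formula n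
  _∧f_ : Formula n → Formula n → Formula n
  _∨f_ : Formula n → Formula n → Formula n
  _⇒f_ : Formula n → Formula n → Formula n

Interp : ℕ → Set
Interp n = Fin n → V3

Classical : ∀ {n} → Interp n → Set
Classical v = ∀ p → ¬ (v p ≡ v1)

tot₃ : V3 → V3
tot₃ v1 = v2
tot₃ x  = x

_ₜ : ∀ {n} → Interp n → Interp n
(v ₜ) p = tot₃ (v p)

-- G3 implication on truth values: 2 if a ≤ b, b otherwise.
imp₃ : V3 → V3 → V3
imp₃ v0 _  = v2
imp₃ v1 v0 = v0
imp₃ v1 _  = v2
imp₃ v2 y  = y

eval : ∀ {n} → Interp n → Formula n → V3
eval v ⊥f       = v0
eval v (atom p) = v p
eval v (a ∧f b) = min₃ (eval v a) (eval v b)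
eval v (a ∨f b) = max₃ (eval v a) (eval v b)
eval v (a ⇒f b) = imp₃ (eval v a) (eval v b)

_≤ᵢ_ : ∀ {n} → Interp n → Interp n → Set
u ≤ᵢ v = ∀ p → (u p ≤₃ v p) × (u p ≡ v0 → v p ≡ v0)

ISet : ℕ → Set₁
ISet n = Interp n → Set

∁ : ∀ {n} → ISet n → ISet n
∁ S v = ¬ S v

_∪ᵢ_ : ∀ {n} → ISet n → ISet n → ISet n
(S ∪ᵢ T) v = S v ⊎ T v

_∩ᵢ_ : ∀ {n} → ISet n → ISet n → ISet n
(S ∩ᵢ T) v = S v × T v

_c : ∀ {n} → ISet n → ISet n
(S c) v = S v × Classical v

_↓ : ∀ {n} → ISet n → ISet n
(S ↓) u = Σ (Interp _) (λ v → S v × (u ≤ᵢ v))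

⟦_⟧ : ∀ {n} → Formula n → ISet n
⟦ ⊥f ⟧ v     = ⊥
⟦ atom p ⟧ v = v p ≡ v2
⟦ a ∧f b ⟧   = ⟦ a ⟧ ∩ᵢ ⟦ b ⟧
⟦ a ∨f b ⟧   = ⟦ a ⟧ ∪ᵢ ⟦ b ⟧
⟦ a ⇒f b ⟧   = (∁ ⟦ a ⟧ ∪ᵢ ⟦ b ⟧) ∩ᵢ (((∁ ⟦ a ⟧ ∪ᵢ ⟦ b ⟧) c) ↓)

-- v ↦ v ₜ commutes with the G3 connectives, so v ₜ evaluates every formula
-- to tot₃ of its value under v.  For implication, the classical part of
-- [[α → β]] lying above v is the single interpretation v ₜ, so the second
-- conjunct of [[α → β]] at v says that α → β holds classically at v ₜ;
-- together with the first conjunct this is exactly the truth table of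
-- imp₃ being 2.  Part (ii) is part (i) at v ₜ, since a truth value is
-- nonzero exactly when tot₃ sends it to 2.
module Submission where

open import Defs
open import Data.Nat using (ℕ)
open import Data.Product using (_×_; _,_)
open import Data.Product.Function.NonDependent.Propositional using (_×-⇔_)
import Data.Product as Product
open import Data.Sum using (_⊎_; inj₁; inj₂)
open import Data.Sum.Function.Propositional using (_⊎-⇔_)
import Data.Sum as Sum
open import Data.Empty using (⊥-elim)
open import Function using (_∘_)
open import Function.Bundles using (_⇔_; mk⇔)
open import Function.Construct.Composition using (_⇔-∘_)
open import Function.Construct.Identity using (⇔-id)
open import Function.Construct.Symmetry using (⇔-sym)
open import Function.Related.Propositional using (module EquationalReasoning; equivalence)
open import Function.Related.TypeIsomorphisms using (→-cong-⇔)
open import Relation.Binary.Definitions using (_Respects_)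
open import Relation.Nullary using (¬_)
open import Relation.Binary.PropositionalEquality
  using (_≡_; _≗_; refl; sym; trans; cong; cong₂; subst)

tot₃-min₃ : ∀ x y → tot₃ (min₃ x y) ≡ min₃ (tot₃ x) (tot₃ y)
tot₃-min₃ v0 y  = refl
tot₃-min₃ v1 v0 = refl
tot₃-min₃ v1 v1 = refl
tot₃-min₃ v1 v2 = refl
tot₃-min₃ v2 y  = refl

tot₃-max₃ : ∀ x y → tot₃ (max₃ x y) ≡ max₃ (tot₃ x) (tot₃ y)
tot₃-max₃ v0 y  = refl
tot₃-max₃ v1 v0 = refl
tot₃-max₃ v1 v1 = refl
tot₃-max₃ v1 v2 = refl
tot₃-max₃ v2 y  = refl

tot₃-imp₃ : ∀ x y → tot₃ (imp₃ x y) ≡ imp₃ (tot₃ x) (tot₃ y)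
tot₃-imp₃ v0 y  = refl
tot₃-imp₃ v1 v0 = refl
tot₃-imp₃ v1 v1 = refl
tot₃-imp₃ v1 v2 = refl
tot₃-imp₃ v2 y  = refl

≢v0⇔tot₃≡v2 : ∀ x → (¬ x ≡ v0) ⇔ (tot₃ x ≡ v2)
≢v0⇔tot₃≡v2 v0 = mk⇔ (λ x≢v0 → ⊥-elim (x≢v0 refl)) (λ ())
≢v0⇔tot₃≡v2 v1 = mk⇔ (λ _ → refl) (λ _ ())
≢v0⇔tot₃≡v2 v2 = mk⇔ (λ _ → refl) (λ _ ())

min₃≡v2⇔ : ∀ x y → (min₃ x y ≡ v2) ⇔ (x ≡ v2 × y ≡ v2)
min₃≡v2⇔ x y = mk⇔ (to x y) λ { (refl , refl) → refl }
  where
  to : ∀ x y → min₃ x y ≡ v2 → x ≡ v2 × y ≡ v2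
  to v1 v0 ()
  to v1 v1 ()
  to v1 v2 ()
  to v2 y  y≡v2 = refl , y≡v2

max₃≡v2⇔ : ∀ x y → (max₃ x y ≡ v2) ⇔ (x ≡ v2 ⊎ y ≡ v2)
max₃≡v2⇔ x y = mk⇔ (to x y) (from x y)
  where
  to : ∀ x y → max₃ x y ≡ v2 → x ≡ v2 ⊎ y ≡ v2
  to v0 y  y≡v2 = inj₂ y≡v2
  to v1 v0 ()
  to v1 v1 ()
  to v1 v2 _    = inj₂ refl
  to v2 y  _    = inj₁ refl

  from : ∀ x y → x ≡ v2 ⊎ y ≡ v2 → max₃ x y ≡ v2
  from v2 y  _ = refl
  from v0 v2 _ = refl
  from v1 v2 _ = refl
  from v0 v0 (inj₂ ())
  from v0 v1 (inj₂ ())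
  from v1 v0 (inj₂ ())
  from v1 v1 (inj₂ ())

imp₃≡v2⇔ : ∀ x y →
  (imp₃ x y ≡ v2) ⇔ ((¬ x ≡ v2 ⊎ y ≡ v2) × (¬ tot₃ x ≡ v2 ⊎ tot₃ y ≡ v2))
imp₃≡v2⇔ x y = mk⇔ (to x y) (from x y)
  where
  to : ∀ x y → imp₃ x y ≡ v2 → (¬ x ≡ v2 ⊎ y ≡ v2) × (¬ tot₃ x ≡ v2 ⊎ tot₃ y ≡ v2)
  to v0 y  _ = inj₁ (λ ()) , inj₁ (λ ())
  to v1 v1 _ = inj₁ (λ ()) , inj₂ refl
  to v1 v2 _ = inj₂ refl   , inj₂ refl
  to v2 v2 _ = inj₂ refl   , inj₂ refl
  to v1 v0 ()
  to v2 v0 ()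
  to v2 v1 ()

  from : ∀ x y → (¬ x ≡ v2 ⊎ y ≡ v2) × (¬ tot₃ x ≡ v2 ⊎ tot₃ y ≡ v2) → imp₃ x y ≡ v2
  from v0 y  _                = refl
  from v1 v1 _                = refl
  from v1 v2 _                = refl
  from v1 v0 (_ , inj₁ ¬2≡2)  = ⊥-elim (¬2≡2 refl)
  from v1 v0 (_ , inj₂ ())
  from v2 y  (inj₁ ¬2≡2 , _)  = ⊥-elim (¬2≡2 refl)
  from v2 y  (inj₂ y≡v2 , _)  = y≡v2

module _ {n : ℕ} where

  eval-ₜ : ∀ (v : Interp n) α → eval (v ₜ) α ≡ tot₃ (eval v α)
  eval-ₜ v ⊥f       = refl
  eval-ₜ v (atom p) = refl
  eval-ₜ v (a ∧f b) =
    trans (cong₂ min₃ (eval-ₜ v a) (eval-ₜ v b)) (sym (tot₃-min₃ (eval v a) (eval v b)))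
  eval-ₜ v (a ∨f b) =
    trans (cong₂ max₃ (eval-ₜ v a) (eval-ₜ v b)) (sym (tot₃-max₃ (eval v a) (eval v b)))
  eval-ₜ v (a ⇒f b) =
    trans (cong₂ imp₃ (eval-ₜ v a) (eval-ₜ v b)) (sym (tot₃-imp₃ (eval v a) (eval v b)))

  ₜ-classical : ∀ (v : Interp n) → Classical (v ₜ)
  ₜ-classical v p with v p
  ... | v0 = λ ()
  ... | v1 = λ ()
  ... | v2 = λ ()

  ≤ᵢ-ₜ : ∀ (v : Interp n) → v ≤ᵢ (v ₜ)
  ≤ᵢ-ₜ v p with v p
  ... | v0 = 0≤any , λ _ → refl
  ... | v1 = 1≤2   , λ ()
  ... | v2 = 2≤2   , λ ()

  ≤ᵢ-respˡ-≗ : ∀ {u u′ w : Interp n} → u ≗ u′ → u ≤ᵢ w → u′ ≤ᵢ w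
  ≤ᵢ-respˡ-≗ {w = w} u≗u′ u≤w p =
    subst (λ x → x ≤₃ w p × (x ≡ v0 → w p ≡ v0)) (u≗u′ p) (u≤w p)

  ≤ᵢ-classical⇒≗ₜ : ∀ {v w : Interp n} → v ≤ᵢ w → Classical w → w ≗ v ₜ
  ≤ᵢ-classical⇒≗ₜ {v} {w} v≤w w-classical p
    with v p | w p | v≤w p | w-classical p
  ... | v0 | _  | _ , 0-stays-0 | _            = 0-stays-0 refl
  ... | v1 | v1 | _             | w-p≢v1       = ⊥-elim (w-p≢v1 refl)
  ... | v1 | v2 | _             | _            = refl
  ... | v2 | v2 | _             | _            = refl

  classical↓⇔ₜ : ∀ {S : ISet n} → S Respects _≗_ → ∀ v → ((S c) ↓) v ⇔ S (v ₜ)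
  classical↓⇔ₜ S-resp v = mk⇔
    (λ { (w , (S-w , w-classical) , v≤w) → S-resp (≤ᵢ-classical⇒≗ₜ v≤w w-classical) S-w })
    (λ S-vₜ → v ₜ , (S-vₜ , ₜ-classical v) , ≤ᵢ-ₜ v)

  ∁∪ᵢ-respects-≗ : ∀ {S T : ISet n} → S Respects _≗_ → T Respects _≗_ →
                   (∁ S ∪ᵢ T) Respects _≗_
  ∁∪ᵢ-respects-≗ S-resp T-resp u≗w = Sum.map (_∘ S-resp (sym ∘ u≗w)) (T-resp u≗w)

  ⟦⟧-respects-≗ : ∀ (α : Formula n) → ⟦ α ⟧ Respects _≗_
  ⟦⟧-respects-≗ ⊥f       _   ()
  ⟦⟧-respects-≗ (atom p) u≗w = trans (sym (u≗w p))
  ⟦⟧-respects-≗ (a ∧f b) u≗w = Product.map (⟦⟧-respects-≗ a u≗w) (⟦⟧-respects-≗ b u≗w)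
  ⟦⟧-respects-≗ (a ∨f b) u≗w = Sum.map (⟦⟧-respects-≗ a u≗w) (⟦⟧-respects-≗ b u≗w)
  ⟦⟧-respects-≗ (a ⇒f b) u≗w (a→b , w′ , a→b-w′ , u≤w′) =
    ∁∪ᵢ-respects-≗ (⟦⟧-respects-≗ a) (⟦⟧-respects-≗ b) u≗w a→b ,
    w′ , a→b-w′ , ≤ᵢ-respˡ-≗ u≗w u≤w′

  eval≡v2⇔⟦⟧ : ∀ (v : Interp n) α → (eval v α ≡ v2) ⇔ ⟦ α ⟧ v
  eval≡v2⇔⟦⟧ v ⊥f       = mk⇔ (λ ()) (λ ())
  eval≡v2⇔⟦⟧ v (atom p) = ⇔-id _
  eval≡v2⇔⟦⟧ v (a ∧f b) =
    (eval≡v2⇔⟦⟧ v a ×-⇔ eval≡v2⇔⟦⟧ v b) ⇔-∘ min₃≡v2⇔ (eval v a) (eval v b)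
  eval≡v2⇔⟦⟧ v (a ∨f b) =
    (eval≡v2⇔⟦⟧ v a ⊎-⇔ eval≡v2⇔⟦⟧ v b) ⇔-∘ max₃≡v2⇔ (eval v a) (eval v b)
  eval≡v2⇔⟦⟧ v (a ⇒f b) = begin
    imp₃ x y ≡ v2
      ∼⟨ imp₃≡v2⇔ x y ⟩
    ((¬ x ≡ v2 ⊎ y ≡ v2) × (¬ tot₃ x ≡ v2 ⊎ tot₃ y ≡ v2))
      ≡⟨ cong₂ (λ x′ y′ → (¬ x ≡ v2 ⊎ y ≡ v2) × (¬ x′ ≡ v2 ⊎ y′ ≡ v2))
               (sym (eval-ₜ v a)) (sym (eval-ₜ v b)) ⟩
    ((¬ x ≡ v2 ⊎ y ≡ v2) × (¬ eval (v ₜ) a ≡ v2 ⊎ eval (v ₜ) b ≡ v2))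
      ∼⟨ implication-clause v ×-⇔ implication-clause (v ₜ) ⟩
    ((∁ ⟦ a ⟧ ∪ᵢ ⟦ b ⟧) v × (∁ ⟦ a ⟧ ∪ᵢ ⟦ b ⟧) (v ₜ))
      ∼⟨ ⇔-id _ ×-⇔ ⇔-sym (classical↓⇔ₜ clause-respects-≗ v) ⟩
    ⟦ a ⇒f b ⟧ v ∎
    where
    open EquationalReasoning {k = equivalence}
    x = eval v a
    y = eval v b

    implication-clause : ∀ u → (¬ eval u a ≡ v2 ⊎ eval u b ≡ v2) ⇔ (∁ ⟦ a ⟧ ∪ᵢ ⟦ b ⟧) u
    implication-clause u = →-cong-⇔ (eval≡v2⇔⟦⟧ u a) (⇔-id _) ⊎-⇔ eval≡v2⇔⟦⟧ u b

    clause-respects-≗ : (∁ ⟦ a ⟧ ∪ᵢ ⟦ b ⟧) Respects _≗_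
    clause-respects-≗ = ∁∪ᵢ-respects-≗ (⟦⟧-respects-≗ a) (⟦⟧-respects-≗ b)

theorem1 : (n : ℕ) (v : Interp n) (α : Formula n) →
    ((eval v α ≡ v2) ⇔ ⟦ α ⟧ v) × ((¬ (eval v α ≡ v0)) ⇔ ⟦ α ⟧ (v ₜ))
theorem1 n v α = eval≡v2⇔⟦⟧ v α , nonzero⇔⟦⟧ₜ
  where
  open EquationalReasoning {k = equivalence}
  nonzero⇔⟦⟧ₜ : (¬ eval v α ≡ v0) ⇔ ⟦ α ⟧ (v ₜ)
  nonzero⇔⟦⟧ₜ = begin
    ¬ eval v α ≡ v0       ∼⟨ ≢v0⇔tot₃≡v2 (eval v α) ⟩
    tot₃ (eval v α) ≡ v2  ≡⟨ cong (_≡ v2) (sym (eval-ₜ v α)) ⟩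
    eval (v ₜ) α ≡ v2     ∼⟨ eval≡v2⇔⟦⟧ (v ₜ) α ⟩
    ⟦ α ⟧ (v ₜ)           ∎
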